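{- For every $M\in\mathbb{N}$ there is $C=C(M)$ depending only on $M$ such that the following holds for all $n\in\mathbb{N}$. Let $g_1,\ldots,g_m\in\mathbb{Z}[x]$ be polynomials such that: (a) $m\leq M$ and $\deg g_i\leq M$ for all $i$; (b) the absolute values of all coefficients of $g_1,\ldots,g_m$ are at most $M\cdot n^M$; (c) $g_1,\ldots,g_m$ have no common factor in $\mathbb{Q}[x]$ of degree $>0$; (d) there is no prime $p\geq n$ dividing all coefficients of $g_1,\ldots,g_m$. Then, for $U_n$ uniformly distributed on $\{1,\ldots,n\}$, $$\mathbb{P}\{\exists p\text{ prime}: p\geq n,\ g_1(U_n)\equiv\cdots\equiv g_m(U_n)\equiv0\ (\mathrm{mod}\ p)\}\leq C/n.$$ -}

module Defs where

open import Data.Nat using (ℕ; zero; suc; _<_; _≤_)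
open import Data.Integer as ℤ using (ℤ)
open import Data.Integer.Divisibility as ℤD using ()
open import Data.Rational as ℚ using (ℚ; 0ℚ)
open import Data.List using (List; []; _∷_; map)
open import Data.Fin using (Fin)
open import Data.Product using (Σ; ∃; _×_)
open import Data.Nat.Primality using (Prime)
open import Relation.Nullary using (¬_)
open import Relation.Binary.PropositionalEquality using (_≡_)

-- Polynomials are represented by coefficient lists, lowest degree first
-- (a₀ ∷ a₁ ∷ … represents a₀ + a₁ x + …); trailing zeros are allowed.

coeffℤ : List ℤ → ℕ → ℤ
coeffℤ []       _       = ℤ.+ 0
coeffℤ (a ∷ _)  zero    = a
coeffℤ (_ ∷ as) (suc k) = coeffℤ as k

coeffℚ : List ℚ → ℕ → ℚ
coeffℚ []       _       = 0ℚ
coeffℚ (a ∷ _)  zero    = a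
coeffℚ (_ ∷ as) (suc k) = coeffℚ as k

DegLe : ℕ → List ℤ → Set
DegLe d g = ∀ k → d < k → coeffℤ g k ≡ ℤ.+ 0

evalℤ : List ℤ → ℤ → ℤ
evalℤ []       x = ℤ.+ 0
evalℤ (a ∷ as) x = a ℤ.+ x ℤ.* evalℤ as x

addℚ : List ℚ → List ℚ → List ℚ
addℚ []       q        = q
addℚ p        []       = p
addℚ (a ∷ p)  (b ∷ q)  = (a ℚ.+ b) ∷ addℚ p q

mulℚ : List ℚ → List ℚ → List ℚ
mulℚ []      q = []
mulℚ (a ∷ p) q = addℚ (map (a ℚ.*_) q) (0ℚ ∷ mulℚ p q)

-- equality of polynomials (coefficientwise, ignoring trailing zeros)
_≈ₚ_ : List ℚ → List ℚ → Set
p ≈ₚ q = ∀ k → coeffℚ p k ≡ coeffℚ q k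

_∣ₚ_ : List ℚ → List ℚ → Set
h ∣ₚ f = ∃ λ q → mulℚ h q ≈ₚ f

PosDeg : List ℚ → Set
PosDeg h = ∃ λ k → 1 ≤ k × ¬ (coeffℚ h k ≡ 0ℚ)

toℚ[x] : List ℤ → List ℚ
toℚ[x] = map (λ a → a ℚ./ 1)

NoCommonFactorℚ : ∀ {m} → (Fin m → List ℤ) → Set
NoCommonFactorℚ {m} g = ¬ (∃ λ (h : List ℚ) → PosDeg h × (∀ i → h ∣ₚ toℚ[x] (g i)))

BadPoint : ∀ {m} → ℕ → (Fin m → List ℤ) → ℕ → Set
BadPoint {m} n g u =
  ∃ λ p → Prime p × n ≤ p × (∀ i → (ℤ.+ p) ℤD.∣ evalℤ (g i) (ℤ.+ u))

-- Euclid's algorithm with pseudo-division, s ↦ lc(r)·s − lc(s)·xᵗ·r, run on g₁, …, gₘ stays inside ℤ[x].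
-- Each step preserves every common zero of the family modulo every p and, read backwards, every common
-- factor in ℚ[x]; so by (c) it ends at a nonzero constant R, divisible by every prime p that divides all
-- gᵢ(u) for some u. There are at most m(M + 1) steps, each replacing a coefficient bound B by 2B², so
-- |R| < nᴷ with K depending only on M, and R has fewer than K prime divisors p ≥ n. Each such p accounts for
-- at most M of the points u ∈ {1, …, n}: M + 1 of them would be roots of every gᵢ that are distinct
-- modulo p ≥ n, forcing p to divide all coefficients, against (d). Hence there are at most M·K bad points.

module Submission where

open import Defs
open import Data.Nat using (ℕ)
open import Data.Integer using (ℤ)
open import Data.Fin using (Fin)
open import Data.List using (List)

module CoefficientFunctions where

  open import Data.Nat as ℕ using (zero; suc; z≤n; s≤s; _≤_)
  open import Data.Nat.Properties using (≤-refl; ≤-trans; m≤n⇒m<n∨m≡n; m≤n⇒m≤1+n)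
  open import Data.Integer using (0ℤ; _+_; _*_; _-_; _^_; ∣_∣; _≟_)
  open import Data.Integer.Properties using (+-identityˡ; +-identityʳ; *-zeroʳ; *-identityˡ; *-assoc)
  open import Data.Integer.Solver using (module +-*-Solver)
  open import Data.List using ([]; _∷_)
  open import Data.Product using (∃; _×_; _,_)
  open import Data.Sum using (_⊎_; inj₁; inj₂)
  open import Function using (_∘_)
  open import Relation.Binary.PropositionalEquality
  open import Relation.Nullary using (¬_; yes; no)
  open +-*-Solver

  Coeffs : Set
  Coeffs = ℕ → ℤ

  Deg< : ℕ → Coeffs → Set
  Deg< d f = ∀ k → d ≤ k → f k ≡ 0ℤ

  Deg≤ : ℕ → Coeffs → Set
  Deg≤ d = Deg< (suc d)

  Deg≤-tail : ∀ {d f} → Deg≤ d f → Deg≤ (ℕ.pred d) (f ∘ suc)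
  Deg≤-tail {zero}  deg k _   = deg (suc k) (s≤s z≤n)
  Deg≤-tail {suc d} deg k d<k = deg (suc k) (s≤s d<k)

  Deg≤-mono : ∀ {d e f} → d ≤ e → Deg≤ d f → Deg≤ e f
  Deg≤-mono d≤e deg k e<k = deg k (≤-trans (s≤s d≤e) e<k)

  Deg≤-lower : ∀ {d f} → Deg≤ (suc d) f → f (suc d) ≡ 0ℤ → Deg≤ d f
  Deg≤-lower deg fd≡0 k d<k with m≤n⇒m<n∨m≡n d<k
  ... | inj₁ 1+d<k = deg k 1+d<k
  ... | inj₂ refl  = fd≡0

  exact-degree : ∀ d f → Deg≤ d f → (∀ k → f k ≡ 0ℤ) ⊎ ∃ λ e → e ≤ d × Deg≤ e f × ¬ f e ≡ 0ℤ
  exact-degree zero f deg with f 0 ≟ 0ℤ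
  ... | yes f₀≡0 = inj₁ λ { zero → f₀≡0 ; (suc k) → deg (suc k) (s≤s z≤n) }
  ... | no  f₀≢0 = inj₂ (0 , z≤n , deg , f₀≢0)
  exact-degree (suc d) f deg with f (suc d) ≟ 0ℤ
  ... | no  fd≢0 = inj₂ (suc d , ≤-refl , deg , fd≢0)
  ... | yes fd≡0 with exact-degree d f (Deg≤-lower deg fd≡0)
  ...   | inj₁ f≡0                       = inj₁ f≡0
  ...   | inj₂ (e , e≤d , deg-e , fe≢0) = inj₂ (e , m≤n⇒m≤1+n e≤d , deg-e , fe≢0)

  -- Horner evaluation, ignoring the coefficients of index > d
  eval : ℕ → Coeffs → ℤ → ℤ
  eval zero    f x = f 0
  eval (suc d) f x = f 0 + x * eval d (f ∘ suc) x

  eval-zeros : ∀ d f x → (∀ k → f k ≡ 0ℤ) → eval d f x ≡ 0ℤ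
  eval-zeros zero    f x f≡0 = f≡0 0
  eval-zeros (suc d) f x f≡0
    rewrite f≡0 0 | eval-zeros d (f ∘ suc) x (f≡0 ∘ suc) = trans (+-identityˡ _) (*-zeroʳ x)

  eval-≤ : ∀ {d e} f x → Deg≤ d f → d ≤ e → eval e f x ≡ eval d f x
  eval-≤ {zero}  {zero}  f x deg z≤n = refl
  eval-≤ {zero}  {suc e} f x deg z≤n
    rewrite eval-zeros e (f ∘ suc) x (λ k → deg (suc k) (s≤s z≤n)) | *-zeroʳ x = +-identityʳ (f 0)
  eval-≤ {suc d} {suc e} f x deg (s≤s d≤e) =
    cong (λ t → f 0 + x * t) (eval-≤ (f ∘ suc) x (Deg≤-tail deg) d≤e)

  evalℤ≡eval : ∀ g d x → Deg≤ d (coeffℤ g) → evalℤ g x ≡ eval d (coeffℤ g) x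
  evalℤ≡eval []       d       x deg = sym (eval-zeros d (coeffℤ []) x (λ _ → refl))
  evalℤ≡eval (a ∷ as) zero    x deg
    rewrite evalℤ≡eval as 0 x (Deg≤-tail deg) | deg 1 (s≤s z≤n) | *-zeroʳ x = +-identityʳ a
  evalℤ≡eval (a ∷ as) (suc d) x deg = cong (λ t → a + x * t) (evalℤ≡eval as d x (Deg≤-tail deg))

  combine : ℤ → Coeffs → ℤ → Coeffs → Coeffs
  combine a f b h k = a * f k - b * h k

  eval-combine : ∀ d a f b h x → eval d (combine a f b h) x ≡ a * eval d f x - b * eval d h x
  eval-combine zero    a f b h x = refl
  eval-combine (suc d) a f b h x rewrite eval-combine d a (f ∘ suc) b (h ∘ suc) x =
    solve 7 (λ a b f₀ h₀ x F H → (a :* f₀ :- b :* h₀) :+ x :* (a :* F :- b :* H)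
                               := a :* (f₀ :+ x :* F) :- b :* (h₀ :+ x :* H))
      refl a b (f 0) (h 0) x (eval d (f ∘ suc) x) (eval d (h ∘ suc) x)

  shift : ℕ → Coeffs → Coeffs
  shift zero    f k       = f k
  shift (suc s) f zero    = 0ℤ
  shift (suc s) f (suc k) = shift s f k

  shift-at : ∀ s f j → shift s f (s ℕ.+ j) ≡ f j
  shift-at zero    f j = refl
  shift-at (suc s) f j = shift-at s f j

  Deg≤-shift : ∀ s {d f} → Deg≤ d f → Deg≤ (s ℕ.+ d) (shift s f)
  Deg≤-shift zero    deg = deg
  Deg≤-shift (suc s) deg (suc k) (s≤s s+d<k) = Deg≤-shift s deg k s+d<k

  eval-shift : ∀ s d f x → eval (s ℕ.+ d) (shift s f) x ≡ x ^ s * eval d f x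
  eval-shift zero    d f x = sym (*-identityˡ _)
  eval-shift (suc s) d f x rewrite eval-shift s d f x =
    trans (+-identityˡ _) (sym (*-assoc x (x ^ s) _))

  shift-bounded : ∀ s {f B} → (∀ k → ∣ f k ∣ ≤ B) → ∀ k → ∣ shift s f k ∣ ≤ B
  shift-bounded zero    f≤B k       = f≤B k
  shift-bounded (suc s) f≤B zero    = z≤n
  shift-bounded (suc s) f≤B (suc k) = shift-bounded s f≤B k

module RationalFactors where

  open CoefficientFunctions
  open import Data.Nat using (zero; suc; z≤n; s≤s)
  open import Data.Integer as ℤ using (0ℤ; 1ℤ)
  import Data.Integer.Properties as ℤ
  open import Data.Rational as ℚ using (ℚ; 0ℚ; 1ℚ; _+_; _*_; _-_; 1/_)
  open import Data.Rational.Properties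
    using (toℚᵘ-injective; toℚᵘ-cong; toℚᵘ-fromℚᵘ; toℚᵘ-homo-+; toℚᵘ-homo-*; toℚᵘ-homo‿-; *-inverseˡ
          ; +-identityˡ; +-identityʳ; *-zeroˡ; *-zeroʳ; *-identityˡ; *-identityʳ)
  open import Data.Rational.Unnormalised as ℚᵘ using (ℚᵘ; mkℚᵘ; *≡*)
  import Data.Rational.Unnormalised.Properties as ℚᵘ
  import Data.Rational.Solver as ℚSolver
  import Data.Integer.Solver as ℤSolver
  open import Data.List using ([]; _∷_; map)
  open import Data.Product using (∃; _,_)
  open import Function using (_∘_)
  open import Relation.Binary.PropositionalEquality
  open import Relation.Nullary using (¬_)

  ι : ℤ → ℚ
  ι a = a ℚ./ 1

  ι-combine : ∀ a x b y → ι (a ℤ.* x ℤ.- b ℤ.* y) ≡ ι a * ι x - ι b * ι y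
  ι-combine a x b y = toℚᵘ-injective (begin
    ℚ.toℚᵘ (ι (a ℤ.* x ℤ.- b ℤ.* y))   ≈⟨ ι≃ᵘ _ ⟩
    ᵘ (a ℤ.* x ℤ.- b ℤ.* y)            ≈⟨ *≡* (solve 4 (λ a x b y →
                                            (a :* x :- b :* y) :* con 1ℤ
                                            := (a :* x :* con 1ℤ :+ (:- (b :* y)) :* con 1ℤ) :* con 1ℤ) refl a x b y) ⟩
    ᵘ a ℚᵘ.* ᵘ x ℚᵘ.- ᵘ b ℚᵘ.* ᵘ y      ≈⟨ ℚᵘ.+-cong (ℚᵘ.*-cong (ι≃ᵘ a) (ι≃ᵘ x))
                                                     (ℚᵘ.-‿cong (ℚᵘ.*-cong (ι≃ᵘ b) (ι≃ᵘ y))) ⟨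
    ℚ.toℚᵘ (ι a) ℚᵘ.* ℚ.toℚᵘ (ι x) ℚᵘ.- ℚ.toℚᵘ (ι b) ℚᵘ.* ℚ.toℚᵘ (ι y)
                                        ≈⟨ ℚᵘ.+-cong (toℚᵘ-homo-* (ι a) (ι x))
                                             (ℚᵘ.≃-trans (toℚᵘ-homo‿- (ι b * ι y))
                                                         (ℚᵘ.-‿cong (toℚᵘ-homo-* (ι b) (ι y)))) ⟨
    ℚ.toℚᵘ (ι a * ι x) ℚᵘ.+ ℚ.toℚᵘ (ℚ.- (ι b * ι y))
                                        ≈⟨ toℚᵘ-homo-+ (ι a * ι x) (ℚ.- (ι b * ι y)) ⟨
    ℚ.toℚᵘ (ι a * ι x - ι b * ι y)     ∎)
    where
      open ℚᵘ.≃-Reasoning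
      open ℤSolver.+-*-Solver
      ᵘ : ℤ → ℚᵘ
      ᵘ a = mkℚᵘ a 0
      ι≃ᵘ : ∀ a → ℚ.toℚᵘ (ι a) ℚᵘ.≃ ᵘ a
      ι≃ᵘ a = toℚᵘ-fromℚᵘ (ᵘ a)

  ι≡0⇒≡0 : ∀ a → ι a ≡ 0ℚ → a ≡ 0ℤ
  ι≡0⇒≡0 a eq with ℚᵘ.≃-trans (ℚᵘ.≃-sym (toℚᵘ-fromℚᵘ (mkℚᵘ a 0))) (toℚᵘ-cong eq)
  ... | *≡* a*1≡0 = trans (sym (ℤ.*-identityʳ a)) a*1≡0

  coeffℚ-addℚ : ∀ p q k → coeffℚ (addℚ p q) k ≡ coeffℚ p k + coeffℚ q k
  coeffℚ-addℚ []      q       k       = sym (+-identityˡ _)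
  coeffℚ-addℚ (a ∷ p) []      k       = sym (+-identityʳ _)
  coeffℚ-addℚ (a ∷ p) (b ∷ q) zero    = refl
  coeffℚ-addℚ (a ∷ p) (b ∷ q) (suc k) = coeffℚ-addℚ p q k

  coeffℚ-scale : ∀ c q k → coeffℚ (map (c *_) q) k ≡ c * coeffℚ q k
  coeffℚ-scale c []      k       = sym (*-zeroʳ c)
  coeffℚ-scale c (a ∷ q) zero    = refl
  coeffℚ-scale c (a ∷ q) (suc k) = coeffℚ-scale c q k

  coeffℚ-mulℚ-∷ : ∀ a h q k → coeffℚ (mulℚ (a ∷ h) q) k ≡ a * coeffℚ q k + coeffℚ (0ℚ ∷ mulℚ h q) k
  coeffℚ-mulℚ-∷ a h q k = trans (coeffℚ-addℚ (map (a *_) q) _ k) (cong (_+ _) (coeffℚ-scale a q k))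

  coeffℚ-mulℚ-linear : ∀ h c q d r k →
    coeffℚ (mulℚ h (addℚ (map (c *_) q) (map (d *_) r))) k ≡ c * coeffℚ (mulℚ h q) k + d * coeffℚ (mulℚ h r) k
  coeffℚ-mulℚ-linear []      c q d r k = solve 2 (λ c d → con 0ℚ := c :* con 0ℚ :+ d :* con 0ℚ) refl c d
    where open ℚSolver.+-*-Solver
  coeffℚ-mulℚ-linear (a ∷ h) c q d r k = begin
    coeffℚ (mulℚ (a ∷ h) l) k
      ≡⟨ coeffℚ-mulℚ-∷ a h l k ⟩
    a * coeffℚ l k + coeffℚ (0ℚ ∷ mulℚ h l) k
      ≡⟨ cong₂ (λ u v → a * u + v) coeffℚ-l (shifted k) ⟩
    a * (c * qₖ + d * rₖ) + (c * Q k + d * R k)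
      ≡⟨ solve 7 (λ a c d qₖ rₖ Qₖ Rₖ → a :* (c :* qₖ :+ d :* rₖ) :+ (c :* Qₖ :+ d :* Rₖ)
                                       := c :* (a :* qₖ :+ Qₖ) :+ d :* (a :* rₖ :+ Rₖ))
                 refl a c d qₖ rₖ (Q k) (R k) ⟩
    c * (a * qₖ + Q k) + d * (a * rₖ + R k)
      ≡⟨ cong₂ (λ u v → c * u + d * v) (coeffℚ-mulℚ-∷ a h q k) (coeffℚ-mulℚ-∷ a h r k) ⟨
    c * coeffℚ (mulℚ (a ∷ h) q) k + d * coeffℚ (mulℚ (a ∷ h) r) k
      ∎
    where
      open ≡-Reasoning
      open ℚSolver.+-*-Solver
      l = addℚ (map (c *_) q) (map (d *_) r)
      qₖ = coeffℚ q k
      rₖ = coeffℚ r k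
      Q R : ℕ → ℚ
      Q j = coeffℚ (0ℚ ∷ mulℚ h q) j
      R j = coeffℚ (0ℚ ∷ mulℚ h r) j
      coeffℚ-l : coeffℚ l k ≡ c * qₖ + d * rₖ
      coeffℚ-l = trans (coeffℚ-addℚ (map (c *_) q) (map (d *_) r) k)
                       (cong₂ _+_ (coeffℚ-scale c q k) (coeffℚ-scale d r k))
      shifted : ∀ j → coeffℚ (0ℚ ∷ mulℚ h l) j ≡ c * Q j + d * R j
      shifted zero    = solve 2 (λ c d → con 0ℚ := c :* con 0ℚ :+ d :* con 0ℚ) refl c d
      shifted (suc j) = coeffℚ-mulℚ-linear h c q d r j

  coeffℚ-mulℚ-shift : ∀ h q k → coeffℚ (mulℚ h (0ℚ ∷ q)) k ≡ coeffℚ (0ℚ ∷ mulℚ h q) k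
  coeffℚ-mulℚ-shift []      q zero    = refl
  coeffℚ-mulℚ-shift []      q (suc k) = refl
  coeffℚ-mulℚ-shift (a ∷ h) q zero    =
    trans (coeffℚ-mulℚ-∷ a h (0ℚ ∷ q) 0) (trans (+-identityʳ _) (*-zeroʳ a))
  coeffℚ-mulℚ-shift (a ∷ h) q (suc k) = begin
    coeffℚ (mulℚ (a ∷ h) (0ℚ ∷ q)) (suc k)          ≡⟨ coeffℚ-mulℚ-∷ a h (0ℚ ∷ q) (suc k) ⟩
    a * coeffℚ q k + coeffℚ (mulℚ h (0ℚ ∷ q)) k     ≡⟨ cong (a * coeffℚ q k +_) (coeffℚ-mulℚ-shift h q k) ⟩
    a * coeffℚ q k + coeffℚ (0ℚ ∷ mulℚ h q) k       ≡⟨ coeffℚ-mulℚ-∷ a h q k ⟨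
    coeffℚ (mulℚ (a ∷ h) q) k                       ∎
    where open ≡-Reasoning

  coeffℚ-mulℚ-one : ∀ h k → coeffℚ (mulℚ h (1ℚ ∷ [])) k ≡ coeffℚ h k
  coeffℚ-mulℚ-one []      k       = refl
  coeffℚ-mulℚ-one (a ∷ h) zero    =
    trans (coeffℚ-mulℚ-∷ a h (1ℚ ∷ []) 0) (trans (+-identityʳ _) (*-identityʳ a))
  coeffℚ-mulℚ-one (a ∷ h) (suc k) =
    trans (coeffℚ-mulℚ-∷ a h (1ℚ ∷ []) (suc k))
          (trans (cong₂ _+_ (*-zeroʳ a) (coeffℚ-mulℚ-one h k)) (+-identityˡ _))

  -- so that h ∣ₚ f unfolds to h ∣ᶜ coeffℚ f
  infix 4 _∣ᶜ_
  _∣ᶜ_ : List ℚ → (ℕ → ℚ) → Set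
  h ∣ᶜ F = ∃ λ q → ∀ k → coeffℚ (mulℚ h q) k ≡ F k

  module _ {h : List ℚ} where

    ∣ᶜ-resp : ∀ {F G} → h ∣ᶜ F → (∀ k → F k ≡ G k) → h ∣ᶜ G
    ∣ᶜ-resp (q , hq≡F) F≡G = q , λ k → trans (hq≡F k) (F≡G k)

    ∣ᶜ-refl : h ∣ᶜ coeffℚ h
    ∣ᶜ-refl = 1ℚ ∷ [] , coeffℚ-mulℚ-one h

    ∣ᶜ-linear : ∀ {F G} c d → h ∣ᶜ F → h ∣ᶜ G → h ∣ᶜ (λ k → c * F k + d * G k)
    ∣ᶜ-linear c d (q , hq≡F) (r , hr≡G) =
      addℚ (map (c *_) q) (map (d *_) r) ,
      λ k → trans (coeffℚ-mulℚ-linear h c q d r k) (cong₂ (λ u v → c * u + d * v) (hq≡F k) (hr≡G k))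

    ∣ᶜ-zero : h ∣ᶜ (λ _ → 0ℚ)
    ∣ᶜ-zero = ∣ᶜ-resp (∣ᶜ-linear 0ℚ 0ℚ ∣ᶜ-refl ∣ᶜ-refl)
                      (λ k → cong₂ _+_ (*-zeroˡ (coeffℚ h k)) (*-zeroˡ (coeffℚ h k)))

    ∣ᶜ-shift₁ : ∀ {F} → h ∣ᶜ F → h ∣ᶜ (λ { zero → 0ℚ ; (suc k) → F k })
    ∣ᶜ-shift₁ (q , hq≡F) = 0ℚ ∷ q , λ { zero    → coeffℚ-mulℚ-shift h q zero
                                      ; (suc k) → trans (coeffℚ-mulℚ-shift h q (suc k)) (hq≡F k) }

    ∣ᶜ-shift : ∀ s f → h ∣ᶜ ι ∘ f → h ∣ᶜ ι ∘ shift s f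
    ∣ᶜ-shift zero    f h∣f = h∣f
    ∣ᶜ-shift (suc s) f h∣f = ∣ᶜ-resp (∣ᶜ-shift₁ (∣ᶜ-shift s f h∣f)) λ { zero → refl ; (suc k) → refl }

    -- from a·f − b·S and S recover f = a⁻¹ (a·f − b·S) + a⁻¹ b · S
    ∣ᶜ-cancel : ∀ a f b S → ¬ a ≡ 0ℤ → h ∣ᶜ ι ∘ combine a f b S → h ∣ᶜ ι ∘ S → h ∣ᶜ ι ∘ f
    ∣ᶜ-cancel a f b S a≢0 h∣comb h∣S = ∣ᶜ-resp (∣ᶜ-linear a⁻¹ (a⁻¹ * ι b) h∣comb h∣S) recover
      where
        instance
          ιa≢0 : ℚ.NonZero (ι a)
          ιa≢0 = ℚ.≢-nonZero (a≢0 ∘ ι≡0⇒≡0 a)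
        a⁻¹ = 1/ ι a
        recover : ∀ k → a⁻¹ * ι (combine a f b S k) + a⁻¹ * ι b * ι (S k) ≡ ι (f k)
        recover k = begin
          a⁻¹ * ι (a ℤ.* f k ℤ.- b ℤ.* S k) + a⁻¹ * ι b * ι (S k)
            ≡⟨ cong (λ t → a⁻¹ * t + a⁻¹ * ι b * ι (S k)) (ι-combine a (f k) b (S k)) ⟩
          a⁻¹ * (ι a * ι (f k) - ι b * ι (S k)) + a⁻¹ * ι b * ι (S k)
            ≡⟨ solve 5 (λ i a x b y → i :* (a :* x :- b :* y) :+ i :* b :* y := i :* a :* x)
                       refl a⁻¹ (ι a) (ι (f k)) (ι b) (ι (S k)) ⟩
          a⁻¹ * ι a * ι (f k)
            ≡⟨ cong (_* ι (f k)) (*-inverseˡ (ι a)) ⟩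
          1ℚ * ι (f k)
            ≡⟨ *-identityˡ _ ⟩
          ι (f k)
            ∎
          where
            open ≡-Reasoning
            open ℚSolver.+-*-Solver

  ιList : ℕ → Coeffs → List ℚ
  ιList zero    f = ι (f 0) ∷ []
  ιList (suc d) f = ι (f 0) ∷ ιList d (f ∘ suc)

  coeffℚ-ιList : ∀ d f → Deg≤ d f → ∀ k → coeffℚ (ιList d f) k ≡ ι (f k)
  coeffℚ-ιList zero    f deg zero    = refl
  coeffℚ-ιList zero    f deg (suc k) = sym (cong ι (deg (suc k) (s≤s z≤n)))
  coeffℚ-ιList (suc d) f deg zero    = refl
  coeffℚ-ιList (suc d) f deg (suc k) = coeffℚ-ιList d (f ∘ suc) (Deg≤-tail deg) k

  coeffℚ-toℚ[x] : ∀ g k → coeffℚ (toℚ[x] g) k ≡ ι (coeffℤ g k)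
  coeffℚ-toℚ[x] []      k       = refl
  coeffℚ-toℚ[x] (a ∷ g) zero    = refl
  coeffℚ-toℚ[x] (a ∷ g) (suc k) = coeffℚ-toℚ[x] g k

module Bounds where

  open import Data.Nat using (zero; suc; z≤n; _≤_; _+_; _*_; _^_)
  open import Data.Nat.Properties
    using (≤-refl; ≤-trans; +-identityʳ; m≤m+n; m≤m*n; +-mono-≤; *-mono-≤; *-monoˡ-≤
          ; m^n>0; ^-monoˡ-≤; ^-distribˡ-+-*; module ≤-Reasoning)
  open import Data.Nat.GeneralisedArithmetic using (iterate)
  open import Data.Integer as ℤ using (∣_∣)
  import Data.Integer.Properties as ℤ
  open import Relation.Binary.PropositionalEquality

  grow : ℕ → ℕ
  grow B = B * B + B * B

  ∣a*x-b*y∣≤grow : ∀ {B} a x b y → ∣ a ∣ ≤ B → ∣ x ∣ ≤ B → ∣ b ∣ ≤ B → ∣ y ∣ ≤ B →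
                   ∣ a ℤ.* x ℤ.- b ℤ.* y ∣ ≤ grow B
  ∣a*x-b*y∣≤grow {B} a x b y ∣a∣≤B ∣x∣≤B ∣b∣≤B ∣y∣≤B = begin
    ∣ a ℤ.* x ℤ.- b ℤ.* y ∣        ≤⟨ ℤ.∣i-j∣≤∣i∣+∣j∣ (a ℤ.* x) (b ℤ.* y) ⟩
    ∣ a ℤ.* x ∣ + ∣ b ℤ.* y ∣      ≡⟨ cong₂ _+_ (ℤ.abs-* a x) (ℤ.abs-* b y) ⟩
    ∣ a ∣ * ∣ x ∣ + ∣ b ∣ * ∣ y ∣  ≤⟨ +-mono-≤ (*-mono-≤ ∣a∣≤B ∣x∣≤B) (*-mono-≤ ∣b∣≤B ∣y∣≤B) ⟩
    grow B                         ∎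
    where open ≤-Reasoning

  ≤grow : ∀ B → B ≤ grow B
  ≤grow zero    = z≤n
  ≤grow (suc b) = ≤-trans (m≤m*n (suc b) (suc b)) (m≤m+n _ _)

  ≤iterate-grow : ∀ N B → B ≤ iterate grow B N
  ≤iterate-grow zero    B = ≤-refl
  ≤iterate-grow (suc N) B = ≤-trans (≤grow B) (≤iterate-grow N (grow B))

  grow-^ : ∀ {n a B} → 2 ≤ n → B ≤ n ^ a → grow B ≤ n ^ suc (a + a)
  grow-^ {n} {a} {B} 2≤n B≤nᵃ = begin
    B * B + B * B      ≤⟨ +-mono-≤ B² B² ⟩
    x + x              ≡⟨ cong (x +_) (+-identityʳ x) ⟨
    2 * x              ≤⟨ *-monoˡ-≤ x 2≤n ⟩
    n * x              ≡⟨ cong (n *_) (^-distribˡ-+-* n a a) ⟨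
    n ^ suc (a + a)    ∎
    where
      open ≤-Reasoning
      x = n ^ a * n ^ a
      B² = *-mono-≤ B≤nᵃ B≤nᵃ

  iterate-grow-^ : ∀ {n} N {a B} → 2 ≤ n → B ≤ n ^ a → iterate grow B N ≤ n ^ iterate (λ e → suc (e + e)) a N
  iterate-grow-^ zero    2≤n B≤nᵃ = B≤nᵃ
  iterate-grow-^ (suc N) {a} 2≤n B≤nᵃ = iterate-grow-^ N 2≤n (grow-^ {a = a} 2≤n B≤nᵃ)

  n≤2^n : ∀ n → n ≤ 2 ^ n
  n≤2^n zero    = z≤n
  n≤2^n (suc n) = +-mono-≤ (m^n>0 2 n) (≤-trans (n≤2^n n) (m≤m+n (2 ^ n) 0))

  M*nᴹ≤n^[M+M] : ∀ {n} M → 2 ≤ n → M * n ^ M ≤ n ^ (M + M)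
  M*nᴹ≤n^[M+M] {n} M 2≤n = subst (M * n ^ M ≤_) (sym (^-distribˡ-+-* n M M))
                              (*-monoˡ-≤ (n ^ M) (≤-trans (n≤2^n M) (^-monoˡ-≤ M 2≤n)))

module Elimination (M : ℕ) {m : ℕ} (g : Fin m → List ℤ) where

  open CoefficientFunctions
  open RationalFactors
  open Bounds
  open import Data.Nat as ℕ using (zero; suc; z≤n; s≤s; s≤s⁻¹; _≤_; _<_; _+_; _*_; _∸_; _≤?_; pred)
  open import Data.Nat.Properties
    using (≤-refl; ≤-trans; ≰⇒≥; m≤n+m; +-mono-≤; +-suc; m∸n+n≡m; pred[n]≤n; suc-pred; n≢0⇒n>0
          ; m≤n⇒m<n∨m≡n; +-commutativeSemigroup)
  open import Algebra.Properties.CommutativeSemigroup +-commutativeSemigroup using (x∙yz≈y∙xz)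
  open import Data.Nat.ListAction using (sum)
  open import Data.Nat.GeneralisedArithmetic using (iterate)
  open import Data.Integer as ℤ using (0ℤ; ∣_∣)
  open import Data.Integer.Solver using (module +-*-Solver)
  open import Data.Integer.Divisibility.Signed using (_∣_; ∣m∣n⇒∣m-n; ∣n⇒∣m*n)
  open import Data.Rational using (ℚ; 0ℚ; 1ℚ)
  open import Data.Rational.Properties using (1≢0)
  import Data.Fin as Fin
  open import Data.List using ([]; _∷_; map; tabulate)
  open import Data.List.Properties using (map-∘)
  open import Data.List.Relation.Unary.All using (All; []; _∷_)
  open import Data.List.Relation.Unary.All.Properties using (tabulate⁻; map⁻)
  open import Data.Product using (∃; _×_; _,_)
  open import Data.Sum using (inj₁; inj₂)
  open import Data.Empty using (⊥-elim)
  open import Function using (_∘_)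
  open import Relation.Binary.PropositionalEquality
  open import Relation.Nullary using (¬_; yes; no)

  CommonZero : ℤ → ℤ → Set
  CommonZero p x = ∀ i → p ∣ evalℤ (g i) x

  record Member (B : ℕ) : Set where
    field
      poly     : Coeffs
      deg      : ℕ
      deg≤M    : deg ≤ M
      degree   : Deg≤ deg poly
      bounded  : ∀ k → ∣ poly k ∣ ≤ B
      vanishes : ∀ p x → CommonZero p x → p ∣ eval M poly x

  open Member

  Exact : ∀ {B} → Member B → Set
  Exact r = ¬ poly r (deg r) ≡ 0ℤ

  weaken : ∀ {B B′} → B ≤ B′ → Member B → Member B′
  weaken B≤B′ r = record
    { poly = poly r ; deg = deg r ; deg≤M = deg≤M r ; degree = degree r
    ; bounded = λ k → ≤-trans (bounded r k) B≤B′ ; vanishes = vanishes r }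

  size : ∀ {B} → List (Member B) → ℕ
  size = sum ∘ map (suc ∘ deg)

  size-weaken : ∀ {B B′} (B≤B′ : B ≤ B′) L → size (map (weaken B≤B′) L) ≡ size L
  size-weaken B≤B′ L = cong sum (sym (map-∘ L))

  size-swap : ∀ {B} (r s : Member B) L → size (r ∷ s ∷ L) ≡ size (s ∷ r ∷ L)
  size-swap r s L = x∙yz≈y∙xz (suc (deg r)) (suc (deg s)) (size L)

  CommonFactor : ∀ {B} → List ℚ → List (Member B) → Set
  CommonFactor h = All (λ r → h ∣ᶜ ι ∘ poly r)

  Complete : ∀ {B} → List (Member B) → Set
  Complete L = ∀ h → CommonFactor h L → ∀ i → h ∣ₚ toℚ[x] (g i)

  Complete-swap : ∀ {B} {r s : Member B} {L} → Complete (r ∷ s ∷ L) → Complete (s ∷ r ∷ L)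
  Complete-swap complete h (h∣s ∷ h∣r ∷ h∣L) = complete h (h∣r ∷ h∣s ∷ h∣L)

  Resultant : ℕ → Set
  Resultant b = ∃ λ R → ¬ R ≡ 0ℤ × ∣ R ∣ ≤ b × (∀ p x → CommonZero p x → p ∣ R)

  weaken-resultant : ∀ {b b′} → b ≤ b′ → Resultant b → Resultant b′
  weaken-resultant b≤b′ (R , R≢0 , ∣R∣≤b , divides) = R , R≢0 , ≤-trans ∣R∣≤b b≤b′ , divides

  constant-resultant : ∀ {B} (r : Member B) → Exact r → deg r ≡ 0 → Resultant B
  constant-resultant r exact deg≡0 = poly r 0 , subst (λ d → ¬ poly r d ≡ 0ℤ) deg≡0 exact , bounded r 0 ,
    λ p x common → subst (p ∣_) (eval-≤ {e = M} (poly r) x (subst (λ d → Deg≤ d (poly r)) deg≡0 (degree r)) z≤n)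
                                (vanishes r p x common)

  normalise : ∀ {B} (L : List (Member B)) →
              ∃ λ (L′ : List (Member B)) →
                All Exact L′ × size L′ ≤ size L × (∀ h → CommonFactor h L′ → CommonFactor h L)
  normalise [] = [] , [] , z≤n , λ _ _ → []
  normalise (r ∷ L) with normalise L | exact-degree (deg r) (poly r) (degree r)
  ... | L′ , exact , size≤ , back | inj₁ r≡0 =
    L′ , exact , ≤-trans size≤ (m≤n+m _ _) ,
    λ h h∣L′ → ∣ᶜ-resp {h} (∣ᶜ-zero {h}) (λ k → cong ι (sym (r≡0 k))) ∷ back h h∣L′
  ... | L′ , exact , size≤ , back | inj₂ (e , e≤deg , degree-e , exact-e) =
    record r { deg = e ; deg≤M = ≤-trans e≤deg (deg≤M r) ; degree = degree-e } ∷ L′ ,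
    exact-e ∷ exact , +-mono-≤ (s≤s e≤deg) size≤ ,
    λ { h (h∣r ∷ h∣L′) → h∣r ∷ back h h∣L′ }

  module Reduction {B} (r s : Member B) (exact : Exact r) (0<deg-r : 0 < deg r) (r≤s : deg r ≤ deg s) where

    a b : ℤ
    a = poly r (deg r)
    b = poly s (deg s)

    t : ℕ
    t = deg s ∸ deg r

    xᵗr : Coeffs
    xᵗr = shift t (poly r)

    t+deg-r≡deg-s : t + deg r ≡ deg s
    t+deg-r≡deg-s = m∸n+n≡m r≤s

    xᵗr-degree : Deg≤ (t + deg r) xᵗr
    xᵗr-degree = Deg≤-shift t (degree r)

    xᵗr-leading : xᵗr (deg s) ≡ a
    xᵗr-leading = subst (λ d → xᵗr d ≡ a) t+deg-r≡deg-s (shift-at t (poly r) (deg r))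

    instance
      deg-s≢0 : ℕ.NonZero (deg s)
      deg-s≢0 = ℕ.>-nonZero (≤-trans 0<deg-r r≤s)

    reduced : Coeffs
    reduced = combine a (poly s) b xᵗr

    reduced-degree : Deg≤ (pred (deg s)) reduced
    reduced-degree k pred<k with m≤n⇒m<n∨m≡n (subst (_≤ k) (suc-pred (deg s)) pred<k)
    ... | inj₁ deg-s<k
      rewrite degree s k deg-s<k | xᵗr-degree k (subst (_< k) (sym t+deg-r≡deg-s) deg-s<k) =
      solve 2 (λ a b → a :* con 0ℤ :- b :* con 0ℤ := con 0ℤ) refl a b
      where open +-*-Solver
    ... | inj₂ refl rewrite xᵗr-leading = solve 2 (λ a b → a :* b :- b :* a := con 0ℤ) refl a b
      where open +-*-Solver

    eval-xᵗr : ∀ x → eval M xᵗr x ≡ x ℤ.^ t ℤ.* eval M (poly r) x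
    eval-xᵗr x = begin
      eval M xᵗr x                          ≡⟨ eval-≤ xᵗr x xᵗr-degree t+deg-r≤M ⟩
      eval (t + deg r) xᵗr x                ≡⟨ eval-shift t (deg r) (poly r) x ⟩
      x ℤ.^ t ℤ.* eval (deg r) (poly r) x   ≡⟨ cong (x ℤ.^ t ℤ.*_) (eval-≤ (poly r) x (degree r) (deg≤M r)) ⟨
      x ℤ.^ t ℤ.* eval M (poly r) x         ∎
      where
        open ≡-Reasoning
        t+deg-r≤M = subst (_≤ M) (sym t+deg-r≡deg-s) (deg≤M s)

    member : Member (grow B)
    member = record
      { poly     = reduced
      ; deg      = pred (deg s)
      ; deg≤M    = ≤-trans pred[n]≤n (deg≤M s)
      ; degree   = reduced-degree
      ; bounded  = λ k → ∣a*x-b*y∣≤grow a (poly s k) b (xᵗr k)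
                           (bounded r (deg r)) (bounded s k) (bounded s (deg s)) (shift-bounded t (bounded r) k)
      ; vanishes = λ p x common → subst (p ∣_) (sym (eval-combine M a (poly s) b xᵗr x))
                     (∣m∣n⇒∣m-n (∣n⇒∣m*n a (vanishes s p x common))
                                (∣n⇒∣m*n b (subst (p ∣_) (sym (eval-xᵗr x))
                                                   (∣n⇒∣m*n (x ℤ.^ t) (vanishes r p x common)))))
      }

    suc-deg-member : suc (deg member) ≡ deg s
    suc-deg-member = suc-pred (deg s)

    factor-back : ∀ h → h ∣ᶜ ι ∘ poly r → h ∣ᶜ ι ∘ reduced → h ∣ᶜ ι ∘ poly s
    factor-back h h∣r h∣reduced = ∣ᶜ-cancel {h} a (poly s) b xᵗr exact h∣reduced (∣ᶜ-shift {h} t (poly r) h∣r)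

  generator : ∀ {B} → (∀ i → DegLe M (g i)) → (∀ i k → ∣ coeffℤ (g i) k ∣ ≤ B) → Fin m → Member B
  generator degree-g bounded-g i = record
    { poly = coeffℤ (g i) ; deg = M ; deg≤M = ≤-refl ; degree = degree-g i ; bounded = bounded-g i
    ; vanishes = λ p x common → subst (p ∣_) (evalℤ≡eval (g i) M x (degree-g i)) (common i) }

  size-tabulate : ∀ {k B} (f : Fin k → Member B) → (∀ i → deg (f i) ≡ M) → size (tabulate f) ≡ k * suc M
  size-tabulate {zero}  f deg≡M = refl
  size-tabulate {suc k} f deg≡M =
    cong₂ (λ d s → suc d + s) (deg≡M Fin.zero) (size-tabulate (f ∘ Fin.suc) (deg≡M ∘ Fin.suc))

  generators-complete : ∀ {B} degree-g (bounded-g : ∀ i k → ∣ coeffℤ (g i) k ∣ ≤ B) →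
                        Complete (tabulate (generator degree-g bounded-g))
  generators-complete degree-g bounded-g h h∣g i with tabulate⁻ h∣g i
  ... | q , hq≡g = q , λ k → trans (hq≡g k) (sym (coeffℚ-toℚ[x] (g i) k))

  module _ (no-common-factor : NoCommonFactorℚ g) where

    ¬Complete[] : ∀ {B} → ¬ Complete {B} []
    ¬Complete[] complete = no-common-factor (x , (1 , s≤s z≤n , 1≢0) , complete x [])
      where
        x : List ℚ
        x = 0ℚ ∷ 1ℚ ∷ []

    ¬Complete-nonconstant : ∀ {B} (r : Member B) → Exact r → 0 < deg r → ¬ Complete (r ∷ [])
    ¬Complete-nonconstant r exact 0<deg complete =
      no-common-factor (h , (deg r , 0<deg , exact ∘ ι≡0⇒≡0 _ ∘ trans (sym (h≡r (deg r)))) ,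
                        complete h (h∣r ∷ []))
      where
        h = ιList M (poly r)
        h≡r = coeffℚ-ιList M (poly r) (Deg≤-mono (deg≤M r) (degree r))
        h∣r = ∣ᶜ-resp {h} (∣ᶜ-refl {h}) h≡r

    process      : ∀ N {B} (L : List (Member B)) → size L ≤ N → Complete L → Resultant (iterate grow B N)
    processExact : ∀ N {B} (L : List (Member B)) → All Exact L → size L ≤ N → Complete L →
                   Resultant (iterate grow B N)
    reduceStep   : ∀ N {B} (r s : Member B) L → Exact r → deg r ≤ deg s → size (r ∷ s ∷ L) ≤ N →
                   Complete (r ∷ s ∷ L) → Resultant (iterate grow B N)

    process N L size≤N complete with normalise L
    ... | L′ , exact , size′≤size , back =
      processExact N L′ exact (≤-trans size′≤size size≤N) (λ h → complete h ∘ back h)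

    processExact N []           _             _      complete = ⊥-elim (¬Complete[] complete)
    processExact N {B} (r ∷ []) (exact ∷ [])  _      complete with deg r ℕ.≟ 0
    ... | yes deg≡0 = weaken-resultant (≤iterate-grow N B) (constant-resultant r exact deg≡0)
    ... | no  deg≢0 = ⊥-elim (¬Complete-nonconstant r exact (n≢0⇒n>0 deg≢0) complete)
    processExact N (r ∷ s ∷ L) (exact-r ∷ exact-s ∷ _) size≤N complete with deg r ≤? deg s
    ... | yes r≤s = reduceStep N r s L exact-r r≤s size≤N complete
    ... | no  r≰s = reduceStep N s r L exact-s (≰⇒≥ r≰s)
                      (subst (_≤ N) (size-swap r s L) size≤N) (Complete-swap {r = r} complete)

    reduceStep zero    r s L _ _ () _
    reduceStep (suc N) {B} r s L exact r≤s size≤N complete with deg r ℕ.≟ 0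
    ... | yes deg≡0 = weaken-resultant (≤iterate-grow (suc N) B) (constant-resultant r exact deg≡0)
    ... | no  deg≢0 = process N (weaken (≤grow B) r ∷ Reduced.member ∷ L′) (s≤s⁻¹ size≤N′) complete′
      where
        module Reduced = Reduction r s exact (n≢0⇒n>0 deg≢0) r≤s
        L′ = map (weaken (≤grow B)) L
        size-drop : size (r ∷ s ∷ L) ≡ suc (size (weaken (≤grow B) r ∷ Reduced.member ∷ L′))
        size-drop = begin
          suc (deg r) + (suc (deg s) + size L)                  ≡⟨ +-suc (suc (deg r)) (deg s + size L) ⟩
          suc (suc (deg r) + (deg s + size L))                  ≡⟨ cong₂ (λ d l → suc (suc (deg r) + (d + l)))
                                                                     Reduced.suc-deg-member (size-weaken (≤grow B) L) ⟨
          suc (suc (deg r) + (suc (deg Reduced.member) + size L′)) ∎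
          where open ≡-Reasoning
        size≤N′ : suc (size (weaken (≤grow B) r ∷ Reduced.member ∷ L′)) ≤ suc N
        size≤N′ = subst (_≤ suc N) size-drop size≤N
        complete′ : Complete (weaken (≤grow B) r ∷ Reduced.member ∷ L′)
        complete′ h (h∣r ∷ h∣reduced ∷ h∣L′) =
          complete h (h∣r ∷ Reduced.factor-back h h∣r h∣reduced ∷ map⁻ h∣L′)

    resultant : ∀ {B} degree-g (bounded-g : ∀ i k → ∣ coeffℤ (g i) k ∣ ≤ B) N → m * suc M ≤ N →
                Resultant (iterate grow B N)
    resultant degree-g bounded-g N m*[1+M]≤N =
      process N (tabulate generators) (subst (_≤ N) (sym (size-tabulate generators (λ _ → refl))) m*[1+M]≤N)
        (generators-complete degree-g bounded-g)
      where generators = generator degree-g bounded-g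

module RootCounting where

  open CoefficientFunctions using (Deg<; evalℤ≡eval)
  open import Data.Nat as ℕ using (zero; suc; z≤n; s≤s; _≤_; _<_)
  open import Data.Nat.Properties as ℕ using (≤-total; <-irrefl; ⊔-lub)
  import Data.Nat.Divisibility as ℕ
  open import Data.Nat.Primality using (Prime; euclidsLemma)
  open import Data.Integer as ℤ using (0ℤ; +_; _+_; _*_; _-_)
  import Data.Integer.Properties as ℤ
  open import Data.Integer.Solver using (module +-*-Solver)
  import Data.Integer.Divisibility as Unsigned
  open import Data.Integer.Divisibility.Signed
    using (_∣_; ∣ᵤ⇒∣; ∣⇒∣ᵤ; ∣m∣n⇒∣m-n; ∣n⇒∣m*n; ∣m+n∣n⇒∣m)
  open import Data.List using ([]; _∷_; length; map)
  open import Data.List.Properties using (length-map)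
  open import Data.List.Relation.Unary.All as All using (All; []; _∷_)
  import Data.List.Relation.Unary.All.Properties as All
  open import Data.List.Relation.Unary.AllPairs using (AllPairs; []; _∷_)
  import Data.List.Relation.Unary.AllPairs.Properties as AllPairs
  open import Data.List.Relation.Unary.Unique.Propositional using (Unique)
  open import Data.Product using (_×_; _,_; proj₁)
  open import Data.Sum using (_⊎_; inj₁; inj₂)
  open import Data.Empty using (⊥-elim)
  open import Relation.Binary.PropositionalEquality
  open import Relation.Nullary using (¬_; yes; no)
  open +-*-Solver

  quot : ℤ → List ℤ → List ℤ
  quot v []       = []
  quot v (a ∷ as) = evalℤ as v ∷ quot v as

  evalℤ-quot : ∀ v g x → evalℤ g x ≡ (x - v) * evalℤ (quot v g) x + evalℤ g v
  evalℤ-quot v []       x = solve 2 (λ x v → con 0ℤ := (x :- v) :* con 0ℤ :+ con 0ℤ) refl x v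
  evalℤ-quot v (a ∷ as) x rewrite evalℤ-quot v as x =
    solve 5 (λ a x v Q r → a :+ x :* ((x :- v) :* Q :+ r) := (x :- v) :* (r :+ x :* Q) :+ (a :+ v :* r))
      refl a x v (evalℤ (quot v as) x) (evalℤ as v)

  coeffℤ-quot-zero : ∀ v g → coeffℤ g 0 ≡ evalℤ g v - v * coeffℤ (quot v g) 0
  coeffℤ-quot-zero v []       = solve 1 (λ v → con 0ℤ := con 0ℤ :- v :* con 0ℤ) refl v
  coeffℤ-quot-zero v (a ∷ as) = solve 3 (λ a v r → a := a :+ v :* r :- v :* r) refl a v (evalℤ as v)

  coeffℤ-quot-suc : ∀ v g k → coeffℤ g (suc k) ≡ coeffℤ (quot v g) k - v * coeffℤ (quot v g) (suc k)
  coeffℤ-quot-suc v []       k       = solve 1 (λ v → con 0ℤ := con 0ℤ :- v :* con 0ℤ) refl v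
  coeffℤ-quot-suc v (a ∷ as) zero    = coeffℤ-quot-zero v as
  coeffℤ-quot-suc v (a ∷ as) (suc k) = coeffℤ-quot-suc v as k

  evalℤ-zeros : ∀ g x → Deg< 0 (coeffℤ g) → evalℤ g x ≡ 0ℤ
  evalℤ-zeros g x g≡0 = trans (evalℤ≡eval g 0 x (λ k _ → g≡0 k z≤n)) (g≡0 0 z≤n)

  Deg<-quot : ∀ v d g → Deg< (suc d) (coeffℤ g) → Deg< d (coeffℤ (quot v g))
  Deg<-quot v d       []       deg k       _       = refl
  Deg<-quot v zero    (a ∷ as) deg zero    _       = evalℤ-zeros as v (λ k _ → deg (suc k) (s≤s z≤n))
  Deg<-quot v zero    (a ∷ as) deg (suc k) _       = Deg<-quot v 0 as (λ j _ → deg (suc j) (s≤s z≤n)) k z≤n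
  Deg<-quot v (suc d) (a ∷ as) deg (suc k) (s≤s d≤k) = Deg<-quot v d as (λ j d<j → deg (suc j) (s≤s d<j)) k d≤k

  Root : ℕ → List ℤ → ℤ → Set
  Root p g v = + p ∣ evalℤ g v

  Incongruent : ℕ → ℤ → ℤ → Set
  Incongruent p v w = ¬ + p ∣ w - v

  module _ {p : ℕ} (p-prime : Prime p) where

    prime-∣-* : ∀ {a b} → + p ∣ a * b → + p ∣ a ⊎ + p ∣ b
    prime-∣-* {a} {b} p∣ab
      with euclidsLemma ℤ.∣ a ∣ ℤ.∣ b ∣ p-prime (subst (p ℕ.∣_) (ℤ.abs-* a b) (∣⇒∣ᵤ p∣ab))
    ... | inj₁ p∣a = inj₁ (∣ᵤ⇒∣ p∣a)
    ... | inj₂ p∣b = inj₂ (∣ᵤ⇒∣ p∣b)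

    roots-quot : ∀ g {v ws} → Root p g v → All (Incongruent p v) ws → All (Root p g) ws → All (Root p (quot v g)) ws
    roots-quot g         root-v []           []               = []
    roots-quot g {v} {w ∷ _} root-v (w≢v ∷ ws≢v) (root-w ∷ roots) with prime-∣-* p∣[w-v]q
      where
        p∣[w-v]q = ∣m+n∣n⇒∣m (subst (+ p ∣_) (evalℤ-quot v g w) root-w) root-v
    ... | inj₁ p∣w-v = ⊥-elim (w≢v p∣w-v)
    ... | inj₂ p∣q   = p∣q ∷ roots-quot g root-v ws≢v roots

    roots⇒∣coeffs : ∀ d g vs → Deg< d (coeffℤ g) → d ≤ length vs →
                    AllPairs (Incongruent p) vs → All (Root p g) vs → ∀ k → + p ∣ coeffℤ g k
    roots⇒∣coeffs zero    g vs       deg _         _              _             k =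
      subst (+ p ∣_) (sym (deg k z≤n)) (∣ᵤ⇒∣ (p ℕ.∣0))
    roots⇒∣coeffs (suc d) g (v ∷ vs) deg (s≤s d≤n) (v≢vs ∷ vs-inc) (root-v ∷ roots) = p∣g
      where
        q = quot v g
        p∣q : ∀ k → + p ∣ coeffℤ q k
        p∣q = roots⇒∣coeffs d q vs (Deg<-quot v d g deg) d≤n vs-inc (roots-quot g root-v v≢vs roots)
        p∣g : ∀ k → + p ∣ coeffℤ g k
        p∣g zero    = subst (+ p ∣_) (sym (coeffℤ-quot-zero v g)) (∣m∣n⇒∣m-n root-v (∣n⇒∣m*n v (p∣q 0)))
        p∣g (suc k) = subst (+ p ∣_) (sym (coeffℤ-quot-suc v g k))
                            (∣m∣n⇒∣m-n (p∣q k) (∣n⇒∣m*n v (p∣q (suc k))))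

  ∣+m-+n∣≡∣m-n∣ : ∀ m n → ℤ.∣ + m - + n ∣ ≡ ℕ.∣ m - n ∣
  ∣+m-+n∣≡∣m-n∣ m n with ≤-total m n
  ... | inj₁ m≤n =
    trans (cong ℤ.∣_∣ (ℤ.m-n≡m⊖n m n)) (trans (ℤ.∣⊖∣-≤ m≤n) (sym (ℕ.m≤n⇒∣m-n∣≡n∸m m≤n)))
  ... | inj₂ n≤m =
    trans (cong ℤ.∣_∣ (trans (ℤ.m-n≡m⊖n m n) (ℤ.⊖-≥ n≤m))) (sym (ℕ.m≤n⇒∣n-m∣≡n∸m n≤m))

  InRange : ℕ → ℕ → Set
  InRange n v = 1 ≤ v × v ≤ n

  distinct⇒incongruent : ∀ {p n v w} → n ≤ p → InRange n v → InRange n w → v ≢ w → Incongruent p (+ v) (+ w)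
  distinct⇒incongruent {p} {n} {suc v} {suc w} n≤p (_ , v≤n) (_ , w≤n) v≢w p∣w-v =
    <-irrefl refl (begin-strict
      p             ≤⟨ p≤∣w-v∣ ⟩
      ℕ.∣ w - v ∣   ≤⟨ ℕ.∣m-n∣≤m⊔n w v ⟩
      w ℕ.⊔ v       <⟨ ⊔-lub w≤n v≤n ⟩
      n             ≤⟨ n≤p ⟩
      p             ∎)
    where
      open ℕ.≤-Reasoning
      instance
        ∣w-v∣≢0 : ℕ.NonZero ℕ.∣ w - v ∣
        ∣w-v∣≢0 = ℕ.≢-nonZero (λ ∣w-v∣≡0 → v≢w (cong suc (sym (ℕ.∣m-n∣≡0⇒m≡n ∣w-v∣≡0))))
      p≤∣w-v∣ : p ≤ ℕ.∣ w - v ∣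
      p≤∣w-v∣ = ℕ.∣⇒≤ (subst (p ℕ.∣_) (∣+m-+n∣≡∣m-n∣ (suc w) (suc v)) (∣⇒∣ᵤ p∣w-v))

  distinct⇒pairwise-incongruent : ∀ {p n vs} → n ≤ p → Unique vs → All (InRange n) vs →
                                  AllPairs (λ v w → Incongruent p (+ v) (+ w)) vs
  distinct⇒pairwise-incongruent n≤p []               []             = []
  distinct⇒pairwise-incongruent n≤p (v≢vs ∷ unique) (v∈ ∷ vs∈) =
    All.zipWith (λ (w∈ , v≢w) → distinct⇒incongruent n≤p v∈ w∈ v≢w) (vs∈ , v≢vs) ∷
    distinct⇒pairwise-incongruent n≤p unique vs∈

  few-common-roots : ∀ {m M n p} (g : Fin m → List ℤ) → Prime p → n ≤ p → (∀ i → DegLe M (g i)) →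
                     ¬ (∀ i k → + p Unsigned.∣ coeffℤ (g i) k) →
                     ∀ vs → Unique vs → All (λ v → InRange n v × ∀ i → + p Unsigned.∣ evalℤ (g i) (+ v)) vs →
                     length vs ≤ M
  few-common-roots {M = M} g p-prime n≤p degree-g not-all vs unique roots with M ℕ.<? length vs
  ... | no  M≮ = ℕ.≮⇒≥ M≮
  ... | yes M< = ⊥-elim (not-all λ i k → ∣⇒∣ᵤ (roots⇒∣coeffs p-prime (suc M) (g i) (map +_ vs) (degree-g i)
                   (subst (M <_) (sym (length-map +_ vs)) M<)
                   (AllPairs.map⁺ (distinct⇒pairwise-incongruent n≤p unique (All.map proj₁ roots)))
                   (All.map⁺ (All.map (λ (_ , root) → ∣ᵤ⇒∣ (root i)) roots)) k))

module PrimeDivisorCounting where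

  open import Data.Nat using (zero; suc; z≤n; _≤_; _<_; _+_; _*_; _^_; nonTrivial⇒≢1)
  open import Data.Nat.Properties
    using (<-≤-trans; ≤-<-trans; <-irrefl; n≢0⇒n>0; +-mono-≤; +-suc; *-suc; *-comm; *-monoˡ-≤; *-cancelˡ-<)
  open import Data.Nat.Divisibility using (_∣_; divides)
  open import Data.Nat.Primality using (Prime; euclidsLemma; prime⇒irreducible; prime⇒nonTrivial)
  open import Data.List using ([]; _∷_; length; filter)
  open import Data.List.Relation.Unary.All as All using (All; _∷_)
  import Data.List.Relation.Unary.All.Properties as All
  open import Data.List.Relation.Unary.Unique.Propositional using (Unique)
  import Data.List.Relation.Unary.Unique.Propositional.Properties as Unique
  open import Data.Product using (∃; _×_; _,_)
  open import Data.Sum using (inj₁; inj₂)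
  open import Data.Empty using (⊥-elim)
  open import Function using (_∘_)
  open import Relation.Binary.PropositionalEquality
  open import Relation.Nullary using (¬_; ¬?; yes; no)
  open import Relation.Unary using (Decidable)

  length-filter-split : ∀ {P : ℕ → Set} (P? : Decidable P) xs →
                        length xs ≡ length (filter P? xs) + length (filter (¬? ∘ P?) xs)
  length-filter-split P? []       = refl
  length-filter-split P? (x ∷ xs) with P? x
  ... | yes _ = cong suc (length-filter-split P? xs)
  ... | no  _ = trans (cong suc (length-filter-split P? xs)) (sym (+-suc _ _))

  prime∣prime⇒≡ : ∀ {q r} → Prime q → Prime r → q ∣ r → q ≡ r
  prime∣prime⇒≡ q-prime r-prime q∣r with prime⇒irreducible r-prime q∣r
  ... | inj₁ q≡1 = ⊥-elim (nonTrivial⇒≢1 {{prime⇒nonTrivial q-prime}} q≡1)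
  ... | inj₂ q≡r = q≡r

  module _ {M n : ℕ} (T : ℕ → ℕ → Set) (T? : ∀ q → Decidable (T q))
           (few : ∀ q → Prime q → n ≤ q → ∀ vs → Unique vs → All (T q) vs → length vs ≤ M) where

    Witnessed : ℕ → ℕ → Set
    Witnessed R u = ∃ λ q → Prime q × n ≤ q × q ∣ R × T q u

    -- each prime divisor q₀ ≥ n of R < nᵏ accounts for at most M points, and R / q₀ < nᵏ⁻¹
    witnessed-points-bound : ∀ k {R} → 0 < R → R < n ^ k → ∀ us → Unique us → All (Witnessed R) us →
                             length us ≤ M * k
    witnessed-points-bound k       _   _   []      _ _ = z≤n
    witnessed-points-bound zero    R>0 R<1 (_ ∷ _) _ _ = ⊥-elim (<-irrefl refl (<-≤-trans R<1 R>0))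
    witnessed-points-bound (suc k) {R} R>0 R<nᵏ⁺¹ us@(_ ∷ _) unique
          witnessed@((q₀ , q₀-prime , n≤q₀ , divides R′ R≡R′q₀ , _) ∷ _) = begin
      length us                                                   ≡⟨ length-filter-split (T? q₀) us ⟩
      length (filter (T? q₀) us) + length (filter (¬? ∘ T? q₀) us) ≤⟨ +-mono-≤ fiber rest ⟩
      M + M * k                                                   ≡⟨ *-suc M k ⟨
      M * suc k                                                   ∎
      where
        open Data.Nat.Properties.≤-Reasoning
        fiber = few q₀ q₀-prime n≤q₀ _ (Unique.filter⁺ (T? q₀) unique) (All.all-filter (T? q₀) us)
        R′>0 : 0 < R′
        R′>0 = n≢0⇒n>0 λ R′≡0 → <-irrefl (sym (trans R≡R′q₀ (cong (_* q₀) R′≡0))) R>0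
        R′<nᵏ : R′ < n ^ k
        R′<nᵏ = *-cancelˡ-< n R′ (n ^ k) (begin-strict
          n * R′   ≤⟨ *-monoˡ-≤ R′ n≤q₀ ⟩
          q₀ * R′  ≡⟨ trans (*-comm q₀ R′) (sym R≡R′q₀) ⟩
          R        <⟨ R<nᵏ⁺¹ ⟩
          n ^ suc k ∎)
        transfer : ∀ {u} → Witnessed R u × ¬ T q₀ u → Witnessed R′ u
        transfer {u} ((q , q-prime , n≤q , q∣R , Tqu) , ¬Tq₀u)
          with euclidsLemma R′ q₀ q-prime (subst (q ∣_) R≡R′q₀ q∣R)
        ... | inj₁ q∣R′ = q , q-prime , n≤q , q∣R′ , Tqu
        ... | inj₂ q∣q₀ = ⊥-elim (¬Tq₀u (subst (λ q → T q u) (prime∣prime⇒≡ q-prime q₀-prime q∣q₀) Tqu))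
        rest = witnessed-points-bound k R′>0 R′<nᵏ _ (Unique.filter⁺ (¬? ∘ T? q₀) unique)
                 (All.zipWith transfer (All.filter⁺ (¬? ∘ T? q₀) witnessed , All.all-filter (¬? ∘ T? q₀) us))


open Bounds using (iterate-grow-^; M*nᴹ≤n^[M+M])
open RootCounting using (InRange; few-common-roots)
open PrimeDivisorCounting using (witnessed-points-bound)
open import Data.Nat using (suc; z≤n; s≤s; _≤_; _<_; _+_; _*_; _^_; _≤?_)
open import Data.Nat.Properties
  using (≤-trans; ≤-<-trans; ≤-antisym; ≰⇒>; m≤n⇒m≤1+n; *-monoˡ-≤; n<1+n; ^-monoʳ-<; n≢0⇒n>0)
import Data.Nat.Divisibility as ℕ
open import Data.Nat.GeneralisedArithmetic using (iterate)
open import Data.Nat.Primality using (Prime)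
open import Data.Integer as ℤ using (+_; ∣_∣)
import Data.Integer.Properties as ℤ
import Data.Integer.Divisibility as ℤD
open import Data.Integer.Divisibility.Signed using (∣ᵤ⇒∣; ∣⇒∣ᵤ)
open import Data.Fin.Properties using (all?)
open import Data.List using ([]; _∷_; length)
open import Data.List.Relation.Unary.All as All using (All; _∷_)
open import Data.List.Relation.Unary.AllPairs using (_∷_)
open import Data.List.Relation.Unary.Unique.Propositional using (Unique)
open import Data.Product using (∃; ∃-syntax; _×_; _,_)
open import Data.Empty using (⊥-elim)
open import Function using (_∘_; case_of_)
open import Relation.Nullary using (¬_; yes; no)
open import Relation.Nullary.Decidable using (_×-dec_)
open import Relation.Unary using (Decidable)
open import Relation.Binary.PropositionalEquality

resultant-exponent : ℕ → ℕ
resultant-exponent M = iterate (λ e → suc (e + e)) (M + M) (M * suc M)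

bad-points-bound : ∀ {M n m} (g : Fin m → List ℤ) → 2 ≤ n →
    m ≤ M →
    (∀ i → DegLe M (g i)) →
    (∀ i k → ∣ coeffℤ (g i) k ∣ ≤ M * n ^ M) →
    NoCommonFactorℚ g →
    ¬ (∃ λ p → Prime p × n ≤ p × (∀ i k → (+ p) ℤD.∣ coeffℤ (g i) k)) →
    (us : List ℕ) → Unique us →
    All (λ u → 1 ≤ u × u ≤ n × BadPoint n g u) us →
    length us ≤ M * suc (resultant-exponent M)
bad-points-bound {M} {n} g 2≤n m≤M degree-g bounded-g no-common-factor no-common-prime us unique bad
  with Elimination.resultant M g no-common-factor degree-g bounded-g (M * suc M) (*-monoˡ-≤ (suc M) m≤M)
... | R , R≢0 , ∣R∣≤ , divisible =
  witnessed-points-bound T T? fiber (suc K) ∣R∣>0 ∣R∣<nᴷ⁺¹ us unique (All.map witness bad)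
  where
    K = resultant-exponent M
    T : ℕ → ℕ → Set
    T q u = InRange n u × ∀ i → (+ q) ℤD.∣ evalℤ (g i) (+ u)
    T? : ∀ q → Decidable (T q)
    T? q u = (1 ≤? u ×-dec u ≤? n) ×-dec all? (λ i → q ℕ.∣? ∣ evalℤ (g i) (+ u) ∣)
    fiber : ∀ q → Prime q → n ≤ q → ∀ vs → Unique vs → All (T q) vs → length vs ≤ M
    fiber q q-prime n≤q = few-common-roots g q-prime n≤q degree-g (λ p∣g → no-common-prime (q , q-prime , n≤q , p∣g))
    ∣R∣>0 : 0 < ∣ R ∣
    ∣R∣>0 = n≢0⇒n>0 (R≢0 ∘ ℤ.∣i∣≡0⇒i≡0)
    ∣R∣<nᴷ⁺¹ : ∣ R ∣ < n ^ suc K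
    ∣R∣<nᴷ⁺¹ = ≤-<-trans (≤-trans ∣R∣≤ (iterate-grow-^ (M * suc M) 2≤n (M*nᴹ≤n^[M+M] M 2≤n)))
                          (^-monoʳ-< n 2≤n (n<1+n K))
    witness : ∀ {u} → 1 ≤ u × u ≤ n × BadPoint n g u → ∃ λ q → Prime q × n ≤ q × q ℕ.∣ ∣ R ∣ × T q u
    witness (1≤u , u≤n , q , q-prime , n≤q , q∣g) =
      q , q-prime , n≤q , ∣⇒∣ᵤ (divisible (+ q) (+ _) (λ i → ∣ᵤ⇒∣ (q∣g i))) , (1≤u , u≤n) , q∣g

at-most-one-point : ∀ {n} {P : ℕ → Set} → n ≤ 1 → (us : List ℕ) → Unique us →
                    All (λ u → 1 ≤ u × u ≤ n × P u) us → length us ≤ 1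
at-most-one-point n≤1 []          _ _ = z≤n
at-most-one-point n≤1 (_ ∷ [])    _ _ = s≤s z≤n
at-most-one-point n≤1 (v ∷ w ∷ _) ((v≢w ∷ _) ∷ _) ((1≤v , v≤n , _) ∷ (1≤w , w≤n , _) ∷ _) =
  ⊥-elim (v≢w (trans (≤-antisym (≤-trans v≤n n≤1) 1≤v) (sym (≤-antisym (≤-trans w≤n n≤1) 1≤w))))

lemma5p3 : (M : ℕ) → ∃[ C ] ((n m : ℕ) (g : Fin m → List ℤ) →
    m ≤ M →
    (∀ i → DegLe M (g i)) →
    (∀ i k → ∣ coeffℤ (g i) k ∣ ≤ M * n ^ M) →
    NoCommonFactorℚ g →
    ¬ (∃ λ p → Prime p × n ≤ p × (∀ i k → (ℤ.+ p) ℤD.∣ coeffℤ (g i) k)) →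
    (us : List ℕ) → Unique us →
    All (λ u → 1 ≤ u × u ≤ n × BadPoint n g u) us →
    length us ≤ C)
lemma5p3 M = suc (M * suc (resultant-exponent M)) ,
  λ n m g m≤M degree-g bounded-g no-common-factor no-common-prime us unique bad → case n ≤? 1 of λ where
    (yes n≤1) → ≤-trans (at-most-one-point n≤1 us unique bad) (s≤s z≤n)
    (no  n≰1) → m≤n⇒m≤1+n (bad-points-bound g (≰⇒> n≰1) m≤M degree-g bounded-g
                                             no-common-factor no-common-prime us unique bad)
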